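{- Let $B=(B_1,\dots,B_L)\in\mathrm{GMLQ}(\alpha,n)$ with labelling $L_G(B)$. (i) Within each row of $L_G(B)$, the largest label of an anti-particle is strictly smaller than the smallest label of a particle. (ii) If $\alpha=\alpha^+$ (i.e. $\alpha_1\ge\alpha_2\ge\cdots\ge\alpha_L$), then $L_G(B)$ restricted to the particles coincides with the Ferrari–Martin labelling $L(B)$, and for each $1\le r\le L$ the anti-particles of row $r$ are labelled $r-1$.
   Context: $\mathrm{GMLQ}(\alpha,n)$: tuples $B=(B_1,\dots,B_L)$ of subsets of $[n]$ with $|B_r|=\alpha_r$ ($\alpha$ a weak composition, $\alpha^+$ its decreasing rearrangement), drawn with rows $1..L$ bottom to top and columns $1..n$ left to right; sites containing a ball are particles, empty sites are anti-particles. Labelling $L_G(B)$: each site of row $L$ gets label $L$ if a particle and $L-1$ if an anti-particle. For $r=L-1,\dots,1$: let $w_1,\dots,w_n$ be the labels of row $r+1$ and order its columns $i_1,\dots,i_n$ so that $w_{i_1}\ge\cdots\ge w_{i_n}$, ties broken left to right; let $s=|B_r|$. Particle phase: for $k=1,\dots,s$, the first not yet labelled particle of row $r$ found weakly to the right of column $i_k$, cyclically, gets label $w_{i_k}$. Anti-particle phase: for $k=n,n-1,\dots,s+1$, the first not yet labelled anti-particle of row $r$ found weakly to the left of column $i_k$, cyclically, gets label $w_{i_k}-1$. Ferrari–Martin labelling $L(B)$ (for $\alpha$ weakly decreasing): for $r=L,\dots,2$, unlabelled balls of row $r$ get label $r$; then the balls of row $r$, by decreasing label and left to right among ties, are each paired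 with the first not yet labelled ball of row $r-1$ weakly to their right, cyclically (from column $n$ to column $1$), which gets the same label; finally unlabelled balls of row $1$ get label $1$. -}

module Defs where

open import Data.Nat using (ℕ; zero; suc; _∸_; _<ᵇ_)
open import Data.Bool using (Bool; true; false; _∧_; not; if_then_else_)
open import Data.Fin using (Fin; toℕ; _≟_)
open import Data.Fin.Subset using (Subset; ∣_∣)
open import Data.List using (List; []; _∷_; _++_; take; drop; reverse; allFin; foldl; filter)
open import Data.Maybe using (Maybe; just; nothing; is-nothing; fromMaybe)
open import Data.Vec using (Vec; []; _∷_; lookup; replicate; map; _[_]≔_; head; zipWith)
import Data.Bool as Bool

-- Rows of a configuration B ∈ GMLQ(α,n) are elements of Subset n
-- (true = ball / particle, false = empty / anti-particle).
-- A configuration with L rows is a Vec (Subset n) L whose entry at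
-- index 0 is row 1 (bottom) and whose last entry is row L (top).

module _ {n : ℕ} where

  -- columns i, i+1, ..., n, 1, ..., i-1  (weakly right, cyclically)
  rightFrom : Fin n → List (Fin n)
  rightFrom i = drop (toℕ i) (allFin n) ++ take (toℕ i) (allFin n)

  -- columns i, i-1, ..., 1, n, ..., i+1  (weakly left, cyclically)
  leftFrom : Fin n → List (Fin n)
  leftFrom i = reverse (take (suc (toℕ i)) (allFin n))
               ++ reverse (drop (suc (toℕ i)) (allFin n))

  firstWhere : (Fin n → Bool) → List (Fin n) → Maybe (Fin n)
  firstWhere p [] = nothing
  firstWhere p (x ∷ xs) = if p x then just x else firstWhere p xs

  insertDec : (Fin n → ℕ) → Fin n → List (Fin n) → List (Fin n)
  insertDec w x [] = x ∷ []
  insertDec w x (y ∷ ys) =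
    if w y <ᵇ w x then x ∷ y ∷ ys else y ∷ insertDec w x ys

  -- sort a list of columns by decreasing key, ties broken left to right
  sortDec : (Fin n → ℕ) → List (Fin n) → List (Fin n)
  sortDec w cs = foldl (λ acc x → insertDec w x acc) [] cs

  Partial : Set
  Partial = Vec (Maybe ℕ) n

  unlabelled : Partial → Fin n → Bool
  unlabelled st j = is-nothing (lookup st j)

  assign : Partial → Maybe (Fin n) → ℕ → Partial
  assign st nothing  l = st
  assign st (just j) l = st [ j ]≔ just l

  finish : ℕ → Partial → Vec ℕ n
  finish d st = map (fromMaybe d) st

  gTop : ℕ → Subset n → Vec ℕ n
  gTop L b = map (λ x → if x then L else L ∸ 1) b

  gStep : Vec ℕ n → Subset n → Vec ℕ n
  gStep w b = finish 0 st₂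
    where
    order : List (Fin n)
    order = sortDec (lookup w) (allFin n)
    s : ℕ
    s = ∣ b ∣
    partStep : Partial → Fin n → Partial
    partStep st c =
      assign st (firstWhere (λ j → lookup b j ∧ unlabelled st j) (rightFrom c))
                (lookup w c)
    antiStep : Partial → Fin n → Partial
    antiStep st c =
      assign st (firstWhere (λ j → not (lookup b j) ∧ unlabelled st j) (leftFrom c))
                (lookup w c ∸ 1)
    st₁ : Partial
    st₁ = foldl partStep (replicate n nothing) (take s order)
    -- k = n, n-1, ..., s+1
    st₂ : Partial
    st₂ = foldl antiStep st₁ (reverse (drop s order))

  LGaux : ∀ {k} → ℕ → Vec (Subset n) k → Vec (Vec ℕ n) k
  LGaux L [] = []
  LGaux L (b ∷ []) = gTop L b ∷ []
  LGaux L (b ∷ b' ∷ bs) with LGaux L (b' ∷ bs)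
  ... | rest = gStep (head rest) b ∷ rest

  -- L_G(B); entry at index i is the label vector of row i+1
  LG : ∀ {L} → Vec (Subset n) L → Vec (Vec ℕ n) L
  LG {L} B = LGaux L B

  -- Ferrari–Martin labelling (only entries at balls are meaningful;
  -- entries at empty sites are set to 0 and never compared)

  fmFill : ℕ → Subset n → Partial → Partial
  fmFill r b st = zipWith (λ x m → if x ∧ is-nothing m then just r else m) b st

  fmStep : ℕ → Vec ℕ n → Subset n → Subset n → Vec ℕ n
  fmStep r w bAbove b = finish 0 (fmFill r b st)
    where
    order : List (Fin n)
    order = sortDec (lookup w) (filter (λ j → lookup bAbove j Bool.≟ true) (allFin n))
    pairStep : Partial → Fin n → Partial
    pairStep st c =
      assign st (firstWhere (λ j → lookup b j ∧ unlabelled st j) (rightFrom c))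
                (lookup w c)
    st : Partial
    st = foldl pairStep (replicate n nothing) order

  -- first argument: index r of the first row of the list
  FMaux : ∀ {k} → ℕ → Vec (Subset n) k → Vec (Vec ℕ n) k
  FMaux r [] = []
  FMaux r (b ∷ []) = finish 0 (fmFill r b (replicate n nothing)) ∷ []
  FMaux r (b ∷ b' ∷ bs) with FMaux (suc r) (b' ∷ bs)
  ... | rest = fmStep r (head rest) b' b ∷ rest

  FM : ∀ {L} → Vec (Subset n) L → Vec (Vec ℕ n) L
  FM B = FMaux 1 B

{-# OPTIONS --safe #-}
-- Both labellings are built row by row from the top, each row by greedy passes:
-- a pass runs through a list of columns of the row above and hands the label of
-- each column to the first unlabelled admissible site (particle, resp.
-- anti-particle) in the cyclic search order of that column.  Every step fills a
-- site while one is left, so a pass with at least as many steps as admissible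
-- sites labels all of them.  In L_G the particles of row r therefore receive the
-- |B_r| largest labels of row r+1 and the anti-particles the others minus one;
-- this gives (i), and all labels of row r are at least r-1.  For (ii), descending
-- induction shows that row r+1 carries its Ferrari–Martin labels, all larger than
-- r by (i), on its balls and r on its anti-particles.  Sorting row r+1 then lists
-- its balls first, in Ferrari–Martin order, so the particle phase replays the
-- Ferrari–Martin pairing and afterwards gives the label r to the remaining
-- |B_r| - |B_{r+1}| balls, as Ferrari–Martin does, while the anti-particles
-- receive r-1.

module Submission where

open import Defs
open import Data.Nat using (ℕ; zero; suc; _+_; _∸_; _⊓_; _<ᵇ_; _<_; _≤_; z≤n; s≤s; z<s)
open import Data.Nat.Properties
open import Data.Bool using (Bool; true; false; _∧_; not; if_then_else_)
import Data.Bool as Bool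
open import Data.Bool.Properties using (∧-conicalˡ; ∧-conicalʳ; ∧-zeroʳ; ¬-not)
open import Data.Empty using (⊥-elim)
open import Data.Product using (_×_; _,_; proj₁; proj₂; ∃-syntax)
open import Data.Fin using (Fin; toℕ; zero; suc) renaming (_≤_ to _≤ᶠ_)
import Data.Fin as Fin
open import Data.Fin.Subset using (Subset; ∣_∣; _∈_; _∉_; _⊆_; _⊂_; ∁)
open import Data.Fin.Subset.Properties using (p⊆q⇒∣p∣≤∣q∣; p⊂q⇒∣p∣<∣q∣; ∣⊥∣≡0; ⊥⊆; ∉⊥; ∣∁p∣≡n∸∣p∣; ∣p∣≤n)
open import Data.Maybe using (Maybe; just; nothing; is-nothing; fromMaybe)
open import Data.Maybe.Properties using (just-injective)
open import Data.List as List using (List; []; _∷_; _++_; take; drop; reverse; allFin; foldl; filter; length)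
open import Data.List.Properties using (length-take; length-drop; length-reverse; length-tabulate; take++drop≡id; foldl-++; ++-identityʳ)
open import Data.List.Relation.Unary.All as All using (All; []; _∷_)
import Data.List.Relation.Unary.All.Properties as All
open import Data.List.Relation.Unary.AllPairs using (AllPairs; []; _∷_)
open import Data.List.Relation.Unary.Any using (here; there)
open import Data.List.Membership.Propositional using () renaming (_∈_ to _∈ₗ_)
open import Data.List.Membership.Propositional.Properties using (∈-allFin; ∈-++⁺ˡ)
open import Data.List.Relation.Binary.Permutation.Propositional as ↭ using (_↭_; ↭-refl; ↭-sym; ↭-trans; ↭-reflexive)
open import Data.List.Relation.Binary.Permutation.Propositional.Properties
  using (∈-resp-↭; All-resp-↭; ↭-length; ↭-reverse; ++⁺; ++⁺ʳ; shift; ++-comm)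
open import Data.Vec as Vec using (Vec; []; _∷_; lookup; replicate; tabulate; _[_]≔_)
open import Data.Vec.Properties
  using ( lookup∘update; lookup∘update′; lookup-map; lookup-zipWith; lookup-replicate
        ; lookup∘tabulate; tabulate∘lookup; tabulate-∘; []=⇒lookup; lookup⇒[]=)
open import Relation.Binary.PropositionalEquality
open import Function using (_∘_)
open import Relation.Nullary using (¬_; yes; no)
open import Relation.Nullary.Reflects using (ofʸ; ofⁿ)
open import Level using (0ℓ)
open import Relation.Unary using (Pred; Decidable)
open import Relation.Unary.Properties using (∁?)

module _ {n : ℕ} where

  ∈-tabulate⁺ : ∀ (f : Fin n → Bool) {j} → f j ≡ true → j ∈ tabulate f
  ∈-tabulate⁺ f {j} fj = lookup⇒[]= j (tabulate f) (trans (lookup∘tabulate f j) fj)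

  ∈-tabulate⁻ : ∀ (f : Fin n → Bool) {j} → j ∈ tabulate f → f j ≡ true
  ∈-tabulate⁻ f {j} j∈ = trans (sym (lookup∘tabulate f j)) ([]=⇒lookup j∈)

  ∉⇒lookup≡false : ∀ {p : Subset n} {j} → j ∉ p → lookup p j ≡ false
  ∉⇒lookup≡false {p} {j} j∉p = ¬-not (j∉p ∘ lookup⇒[]= j p)

  x∈p⇒0<∣p∣ : ∀ {p : Subset n} {j} → j ∈ p → 0 < ∣ p ∣
  x∈p⇒0<∣p∣ {p} j∈p = subst (_< ∣ p ∣) (∣⊥∣≡0 n) (p⊂q⇒∣p∣<∣q∣ (⊥⊆ , _ , j∈p , ∉⊥))

length-filter-tabulate : ∀ {k m} (p : Fin m → Bool) (g : Fin k → Fin m)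
  → length (filter (λ j → p j Bool.≟ true) (List.tabulate g)) ≡ ∣ tabulate (λ i → p (g i)) ∣
length-filter-tabulate {zero}  p g = refl
length-filter-tabulate {suc k} p g with p (g zero)
... | true  = cong suc (length-filter-tabulate p (λ i → g (suc i)))
... | false = length-filter-tabulate p (λ i → g (suc i))

length-filter-∈ : ∀ {n} (b : Subset n) → length (filter (λ j → lookup b j Bool.≟ true) (allFin n)) ≡ ∣ b ∣
length-filter-∈ b = trans (length-filter-tabulate (lookup b) (λ j → j)) (cong ∣_∣ (tabulate∘lookup b))

module _ {A : Set} where

  take-++ : ∀ (xs ys : List A) k → take (length xs + k) (xs ++ ys) ≡ xs ++ take k ys
  take-++ []       ys k = refl
  take-++ (x ∷ xs) ys k = cong (x ∷_) (take-++ xs ys k)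

  drop-++ : ∀ (xs ys : List A) k → drop (length xs + k) (xs ++ ys) ≡ drop k ys
  drop-++ []       ys k = refl
  drop-++ (x ∷ xs) ys k = drop-++ xs ys k

  AllPairs-++⇒across : ∀ {R : A → A → Set} xs {ys} → AllPairs R (xs ++ ys)
    → ∀ {x y} → x ∈ₗ xs → y ∈ₗ ys → R x y
  AllPairs-++⇒across (x ∷ xs) (Rx ∷ _)  (here refl) y∈ = All.lookup (All.++⁻ʳ xs Rx) y∈
  AllPairs-++⇒across (x ∷ xs) (_ ∷ Rxs) (there x∈)  y∈ = AllPairs-++⇒across xs Rxs x∈ y∈

-- Stable sorting by decreasing key

module _ {n : ℕ} where

  sortInto : (Fin n → ℕ) → List (Fin n) → List (Fin n) → List (Fin n)
  sortInto w = foldl (λ acc x → insertDec w x acc)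

  insertDec-↭ : ∀ w x (ys : List (Fin n)) → insertDec w x ys ↭ x ∷ ys
  insertDec-↭ w x []       = ↭-refl
  insertDec-↭ w x (y ∷ ys) with w y <ᵇ w x
  ... | true  = ↭-refl
  ... | false = ↭-trans (↭.prep y (insertDec-↭ w x ys)) (↭.swap y x ↭-refl)

  sortInto-↭ : ∀ w acc (xs : List (Fin n)) → sortInto w acc xs ↭ acc ++ xs
  sortInto-↭ w acc []       = ↭-reflexive (sym (++-identityʳ acc))
  sortInto-↭ w acc (x ∷ xs) =
    ↭-trans (sortInto-↭ w (insertDec w x acc) xs)
      (↭-trans (++⁺ʳ xs (insertDec-↭ w x acc)) (↭-sym (shift x acc xs)))

  sortDec-↭ : ∀ w (xs : List (Fin n)) → sortDec w xs ↭ xs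
  sortDec-↭ w = sortInto-↭ w []

  Descending : (Fin n → ℕ) → List (Fin n) → Set
  Descending w = AllPairs (λ x y → w y ≤ w x)

  insertDec-descending : ∀ w x {ys} → Descending w ys → Descending w (insertDec w x ys)
  insertDec-descending w x {[]}     [] = [] ∷ []
  insertDec-descending w x {y ∷ ys} (y≥ys ∷ ys↓) with w y <ᵇ w x | <ᵇ-reflects-< (w y) (w x)
  ... | true  | ofʸ y<x  = (<⇒≤ y<x ∷ All.map (λ z≤y → ≤-trans z≤y (<⇒≤ y<x)) y≥ys) ∷ y≥ys ∷ ys↓
  ... | false | ofⁿ y≮x  =
    All-resp-↭ (↭-sym (insertDec-↭ w x ys)) (≮⇒≥ y≮x ∷ y≥ys) ∷ insertDec-descending w x ys↓

  sortInto-descending : ∀ w {acc} xs → Descending w acc → Descending w (sortInto w acc xs)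
  sortInto-descending w []       acc↓ = acc↓
  sortInto-descending w (x ∷ xs) acc↓ = sortInto-descending w xs (insertDec-descending w x acc↓)

  sortDec-descending : ∀ w xs → Descending w (sortDec w xs)
  sortDec-descending w xs = sortInto-descending w xs []

  sortDec-cong : ∀ {w w′} xs → All (λ x → w x ≡ w′ x) xs → sortDec w xs ≡ sortDec w′ xs
  sortDec-cong {w} {w′} xs = sortInto-cong [] xs []
    where
    insert-cong : ∀ {x} ys → w x ≡ w′ x → All (λ y → w y ≡ w′ y) ys → insertDec w x ys ≡ insertDec w′ x ys
    insert-cong []       _  []        = refl
    insert-cong {x} (y ∷ ys) ex (ey ∷ eys) =
      cong₂ (λ c r → if c then x ∷ y ∷ ys else y ∷ r) (cong₂ _<ᵇ_ ey ex) (insert-cong ys ex eys)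
    sortInto-cong : ∀ acc xs → All (λ y → w y ≡ w′ y) acc → All (λ x → w x ≡ w′ x) xs
       → sortInto w acc xs ≡ sortInto w′ acc xs
    sortInto-cong acc []       _    []        = refl
    sortInto-cong acc (x ∷ xs) eacc (ex ∷ exs) =
      trans (cong (λ a → sortInto w a xs) (insert-cong acc ex eacc))
            (sortInto-cong (insertDec w′ x acc) xs (All-resp-↭ (↭-sym (insertDec-↭ w′ x acc)) (ex ∷ eacc)) exs)

  module _ (w : Fin n → ℕ) {P : Pred (Fin n) 0ℓ} (P? : Decidable P)
           (gap : ∀ {x y} → P x → ¬ P y → w y < w x) where

    private
      insert-before : ∀ {x} xs {ys} → P x → All (λ y → ¬ P y) ys → insertDec w x (xs ++ ys) ≡ insertDec w x xs ++ ys
      insert-before {x} [] {[]} _ _ = refl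
      insert-before {x} [] {y ∷ ys} px (¬py ∷ _) with w y <ᵇ w x | <ᵇ-reflects-< (w y) (w x)
      ... | true  | _        = refl
      ... | false | ofⁿ y≮x  = ⊥-elim (y≮x (gap px ¬py))
      insert-before {x} (z ∷ xs) px ¬pys with w z <ᵇ w x
      ... | true  = refl
      ... | false = cong (z ∷_) (insert-before xs px ¬pys)

      insert-after : ∀ {x} xs {ys} → ¬ P x → All P xs → insertDec w x (xs ++ ys) ≡ xs ++ insertDec w x ys
      insert-after {x} [] _ _ = refl
      insert-after {x} (z ∷ xs) ¬px (pz ∷ pxs) with w z <ᵇ w x | <ᵇ-reflects-< (w z) (w x)
      ... | true  | ofʸ z<x = ⊥-elim (<⇒≱ z<x (<⇒≤ (gap pz ¬px)))
      ... | false | _       = cong (z ∷_) (insert-after xs ¬px pxs)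

      sortInto-partition : ∀ xs ys zs → All P xs → All (λ y → ¬ P y) ys
        → sortInto w (xs ++ ys) zs ≡ sortInto w xs (filter P? zs) ++ sortInto w ys (filter (∁? P?) zs)
      sortInto-partition xs ys []       _   _    = refl
      sortInto-partition xs ys (z ∷ zs) pxs ¬pys with P? z
      ... | yes pz rewrite insert-before xs {ys} pz ¬pys =
        sortInto-partition (insertDec w z xs) ys zs (All-resp-↭ (↭-sym (insertDec-↭ w z xs)) (pz ∷ pxs)) ¬pys
      ... | no ¬pz rewrite insert-after xs {ys} ¬pz pxs =
        sortInto-partition xs (insertDec w z ys) zs pxs (All-resp-↭ (↭-sym (insertDec-↭ w z ys)) (¬pz ∷ ¬pys))

    sortDec-partition : ∀ zs → sortDec w zs ≡ sortDec w (filter P? zs) ++ sortDec w (filter (∁? P?) zs)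
    sortDec-partition zs = sortInto-partition [] [] zs [] []

-- Greedy labelling passes

module _ {n : ℕ} where

  rightFrom-↭ : ∀ (c : Fin n) → rightFrom c ↭ allFin n
  rightFrom-↭ c = ↭-trans (++-comm (drop (toℕ c) (allFin n)) _) (↭-reflexive (take++drop≡id (toℕ c) (allFin n)))

  leftFrom-↭ : ∀ (c : Fin n) → leftFrom c ↭ allFin n
  leftFrom-↭ c = ↭-trans (++⁺ (↭-reverse (take k (allFin n))) (↭-reverse (drop k (allFin n))))
                         (↭-reflexive (take++drop≡id k (allFin n)))
    where k = suc (toℕ c)

  ∈-rightFrom : ∀ (c j : Fin n) → j ∈ₗ rightFrom c
  ∈-rightFrom c j = ∈-resp-↭ (↭-sym (rightFrom-↭ c)) (∈-allFin j)

  ∈-leftFrom : ∀ (c j : Fin n) → j ∈ₗ leftFrom c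
  ∈-leftFrom c j = ∈-resp-↭ (↭-sym (leftFrom-↭ c)) (∈-allFin j)

  firstWhere-just : ∀ (p : Fin n → Bool) xs {i} → firstWhere p xs ≡ just i → p i ≡ true
  firstWhere-just p (x ∷ xs) eq with p x in px
  ... | true  = subst (λ y → p y ≡ true) (just-injective eq) px
  ... | false = firstWhere-just p xs eq

  firstWhere-nothing : ∀ (p : Fin n → Bool) xs → firstWhere p xs ≡ nothing → ∀ {j} → j ∈ₗ xs → p j ≡ false
  firstWhere-nothing p (x ∷ xs) eq  j∈         with p x in px
  firstWhere-nothing p (x ∷ xs) ()  j∈          | true
  firstWhere-nothing p (x ∷ xs) eq  (here refl) | false = px
  firstWhere-nothing p (x ∷ xs) eq  (there j∈)  | false = firstWhere-nothing p xs eq j∈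

module Greedy {n : ℕ} (q : Fin n → Bool) (search : Fin n → List (Fin n)) (label : Fin n → ℕ) where

  step : Partial → Fin n → Partial
  step st c = assign st (firstWhere (λ j → q j ∧ unlabelled st j) (search c)) (label c)

  run : Partial → List (Fin n) → Partial
  run = foldl step

  data Fate (st st′ : Partial) (cs : List (Fin n)) (j : Fin n) : Set where
    kept   : lookup st′ j ≡ lookup st j → Fate st st′ cs j
    filled : ∀ {c} → q j ≡ true → lookup st j ≡ nothing → c ∈ₗ cs → lookup st′ j ≡ just (label c)
           → Fate st st′ cs j

  step-fate : ∀ st c j → Fate st (step st c) (c ∷ []) j
  step-fate st c j with firstWhere (λ j → q j ∧ unlabelled st j) (search c) in eq
  ... | nothing = kept refl
  ... | just i with i Fin.≟ j | firstWhere-just _ (search c) eq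
  ...   | yes refl | hole = filled (∧-conicalˡ _ _ hole) (is-nothing⇒≡nothing (∧-conicalʳ _ _ hole)) (here refl)
                                   (lookup∘update i st (just (label c)))
    where
    is-nothing⇒≡nothing : ∀ {m : Maybe ℕ} → is-nothing m ≡ true → m ≡ nothing
    is-nothing⇒≡nothing {nothing} _ = refl
  ...   | no i≢j   | _    = kept (lookup∘update′ (i≢j ∘ sym) st (just (label c)))

  run-fate : ∀ st cs j → Fate st (run st cs) cs j
  run-fate st []       j = kept refl
  run-fate st (c ∷ cs) j with step-fate st c j | run-fate (step st c) cs j
  ... | kept e₁                | kept e₂                  = kept (trans e₂ e₁)
  ... | kept e₁                | filled qj empty c∈ e₂    = filled qj (trans (sym e₁) empty) (there c∈) e₂
  ... | filled qj empty c∈ e₁  | kept e₂                  = filled qj empty (∈-++⁺ˡ c∈) (trans e₂ e₁)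
  ... | filled _ _ _ e₁        | filled _ empty _ _       with () ← trans (sym e₁) empty

  run-outside : ∀ st cs {j} → q j ≡ false → lookup (run st cs) j ≡ lookup st j
  run-outside st cs {j} qj with run-fate st cs j
  ... | kept e            = e
  ... | filled qj′ _ _ _  with () ← trans (sym qj) qj′

  holes : Partial → Subset n
  holes st = tabulate (λ j → q j ∧ unlabelled st j)

  ∈-holes⁺ : ∀ st {j} → q j ∧ unlabelled st j ≡ true → j ∈ holes st
  ∈-holes⁺ st = ∈-tabulate⁺ (λ j → q j ∧ unlabelled st j)

  ∈-holes⁻ : ∀ st {j} → j ∈ holes st → q j ∧ unlabelled st j ≡ true
  ∈-holes⁻ st = ∈-tabulate⁻ (λ j → q j ∧ unlabelled st j)

  labelled-∉-holes : ∀ st {j x} → lookup st j ≡ just x → j ∉ holes st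
  labelled-∉-holes st {j} e j∈ with () ← trans (sym (∧-zeroʳ (q j)))
                                           (subst (λ m → q j ∧ is-nothing m ≡ true) e (∈-holes⁻ st j∈))

  holes-⊆ : ∀ st cs → holes (run st cs) ⊆ holes st
  holes-⊆ st cs {j} j∈ with run-fate st cs j
  ... | kept e          = ∈-holes⁺ st (subst (λ m → q j ∧ is-nothing m ≡ true) e (∈-holes⁻ (run st cs) j∈))
  ... | filled _ _ _ e  = ⊥-elim (labelled-∉-holes (run st cs) e j∈)

  step-holes-⊂ : ∀ st c {j} → j ∈ₗ search c → j ∈ holes st → holes (step st c) ⊂ holes st
  step-holes-⊂ st c {j} j∈search j∈holes = holes-⊆ st (c ∷ []) , found
    where
    found : ∃[ i ] i ∈ holes st × i ∉ holes (step st c)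
    found with firstWhere (λ j → q j ∧ unlabelled st j) (search c) in eq
    ... | just i  = i , ∈-holes⁺ st (firstWhere-just _ (search c) eq)
                      , labelled-∉-holes (st [ i ]≔ just (label c)) (lookup∘update i st (just (label c)))
    ... | nothing with () ← trans (sym (∈-holes⁻ st j∈holes)) (firstWhere-nothing _ (search c) eq j∈search)

  length<∣holes∣ : (∀ c j → j ∈ₗ search c) → ∀ st cs {j} → j ∈ holes (run st cs) → length cs < ∣ holes st ∣
  length<∣holes∣ covers st []       j∈ = x∈p⇒0<∣p∣ j∈
  length<∣holes∣ covers st (c ∷ cs) {j} j∈ =
    ≤-trans (s≤s (length<∣holes∣ covers (step st c) cs j∈))
            (p⊂q⇒∣p∣<∣q∣ (step-holes-⊂ st c (covers c j) (holes-⊆ st (c ∷ cs) j∈)))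

  run-complete : (∀ c j → j ∈ₗ search c) → ∀ st cs → ∣ tabulate q ∣ ≤ length cs
               → ∀ {j} → q j ≡ true → lookup (run st cs) j ≢ nothing
  run-complete covers st cs bound qj unlabelled-j =
    <⇒≱ (length<∣holes∣ covers st cs (∈-holes⁺ (run st cs) (cong₂ _∧_ qj (cong is-nothing unlabelled-j))))
        (≤-trans (p⊆q⇒∣p∣≤∣q∣ (∈-tabulate⁺ q ∘ ∧-conicalˡ _ _ ∘ ∈-holes⁻ st)) bound)

run-cong : ∀ {n} (q : Fin n → Bool) search {label label′ : Fin n → ℕ} st cs
         → All (λ c → label c ≡ label′ c) cs → Greedy.run q search label st cs ≡ Greedy.run q search label′ st cs
run-cong q search st []       []       = refl
run-cong q search st (c ∷ cs) (e ∷ es) rewrite e = run-cong q search _ cs es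

module GStep {n : ℕ} (w : Vec ℕ n) (b : Subset n) where

  order : List (Fin n)
  order = sortDec (lookup w) (allFin n)

  module Particles     = Greedy (lookup b) rightFrom (lookup w)
  module Antiparticles = Greedy (not ∘ lookup b) leftFrom (λ c → lookup w c ∸ 1)

  particlePhase : Partial
  particlePhase = Particles.run (replicate n nothing) (take ∣ b ∣ order)

  antiparticlePhase : Partial
  antiparticlePhase = Antiparticles.run particlePhase (reverse (drop ∣ b ∣ order))

  lookup-gStep : ∀ j → lookup (gStep w b) j ≡ fromMaybe 0 (lookup antiparticlePhase j)
  lookup-gStep j = lookup-map j (fromMaybe 0) antiparticlePhase

  length-order : length order ≡ n
  length-order = trans (↭-length (sortDec-↭ (lookup w) (allFin n))) (length-tabulate (λ j → j))

  taken≥dropped : ∀ {c c′} → c ∈ₗ take ∣ b ∣ order → c′ ∈ₗ drop ∣ b ∣ order → lookup w c′ ≤ lookup w c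
  taken≥dropped = AllPairs-++⇒across (take ∣ b ∣ order)
    (subst (Descending (lookup w)) (sym (take++drop≡id ∣ b ∣ order)) (sortDec-descending (lookup w) (allFin n)))

  antiparticles-keep-particles : ∀ {j} → lookup b j ≡ true → lookup antiparticlePhase j ≡ lookup particlePhase j
  antiparticles-keep-particles bj = Antiparticles.run-outside particlePhase (reverse (drop ∣ b ∣ order)) (cong not bj)

  particles-skip-antiparticles : ∀ {j} → lookup b j ≡ false → lookup particlePhase j ≡ nothing
  particles-skip-antiparticles {j} bj =
    trans (Particles.run-outside (replicate n nothing) (take ∣ b ∣ order) bj) (lookup-replicate j nothing)

  particles-labelled : ∀ {j} → lookup b j ≡ true → lookup particlePhase j ≢ nothing
  particles-labelled = Particles.run-complete ∈-rightFrom
    (replicate n nothing) (take ∣ b ∣ order)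
    (≤-reflexive (begin
      ∣ tabulate (lookup b) ∣          ≡⟨ cong ∣_∣ (tabulate∘lookup b) ⟩
      ∣ b ∣                            ≡⟨ sym (m≤n⇒m⊓n≡m (∣p∣≤n b)) ⟩
      ∣ b ∣ ⊓ n                        ≡⟨ cong (∣ b ∣ ⊓_) length-order ⟨
      ∣ b ∣ ⊓ length order             ≡⟨ length-take ∣ b ∣ order ⟨
      length (take ∣ b ∣ order)        ∎))
    where open ≡-Reasoning

  antiparticles-labelled : ∀ {j} → lookup b j ≡ false → lookup antiparticlePhase j ≢ nothing
  antiparticles-labelled bj = Antiparticles.run-complete ∈-leftFrom
    particlePhase (reverse (drop ∣ b ∣ order))
    (≤-reflexive (begin
      ∣ tabulate (not ∘ lookup b) ∣               ≡⟨ cong ∣_∣ (tabulate-∘ not (lookup b)) ⟩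
      ∣ Vec.map not (tabulate (lookup b)) ∣       ≡⟨ cong (∣_∣ ∘ Vec.map not) (tabulate∘lookup b) ⟩
      ∣ ∁ b ∣                                     ≡⟨ ∣∁p∣≡n∸∣p∣ b ⟩
      n ∸ ∣ b ∣                                   ≡⟨ cong (_∸ ∣ b ∣) length-order ⟨
      length order ∸ ∣ b ∣                        ≡⟨ length-drop ∣ b ∣ order ⟨
      length (drop ∣ b ∣ order)                   ≡⟨ length-reverse (drop ∣ b ∣ order) ⟨
      length (reverse (drop ∣ b ∣ order))         ∎))
    (cong not bj)
    where open ≡-Reasoning

  gStep-particle : ∀ {j} → lookup b j ≡ true → ∃[ c ] c ∈ₗ take ∣ b ∣ order × lookup (gStep w b) j ≡ lookup w c
  gStep-particle {j} bj with Particles.run-fate (replicate n nothing) (take ∣ b ∣ order) j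
  ... | Particles.kept e                = ⊥-elim (particles-labelled bj (trans e (lookup-replicate j nothing)))
  ... | Particles.filled {c} _ _ c∈ e   =
    c , c∈ , trans (lookup-gStep j) (cong (fromMaybe 0) (trans (antiparticles-keep-particles bj) e))

  gStep-antiparticle : ∀ {j} → lookup b j ≡ false
                     → ∃[ c ] c ∈ₗ drop ∣ b ∣ order × lookup (gStep w b) j ≡ lookup w c ∸ 1
  gStep-antiparticle {j} bj with Antiparticles.run-fate particlePhase (reverse (drop ∣ b ∣ order)) j
  ... | Antiparticles.kept e              = ⊥-elim (antiparticles-labelled bj (trans e (particles-skip-antiparticles bj)))
  ... | Antiparticles.filled {c} _ _ c∈ e =
    c , ∈-resp-↭ (↭-reverse (drop ∣ b ∣ order)) c∈ , trans (lookup-gStep j) (cong (fromMaybe 0) e)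

-- Part (i), row by row

module _ {n : ℕ} where

  Separated : Subset n → Vec ℕ n → Set
  Separated b v = ∀ j k → lookup b j ≡ false → lookup b k ≡ true → lookup v j < lookup v k

  Graded : ℕ → Subset n → Vec ℕ n → Set
  Graded R b v = (∀ j → R ≤ lookup v j) × Separated b v

  gTop-particle : ∀ L (b : Subset n) j → lookup b j ≡ true → lookup (gTop L b) j ≡ L
  gTop-particle L b j bj = trans (lookup-map j _ b) (cong (λ x → if x then L else L ∸ 1) bj)

  gTop-antiparticle : ∀ L (b : Subset n) j → lookup b j ≡ false → lookup (gTop L b) j ≡ L ∸ 1
  gTop-antiparticle L b j bj = trans (lookup-map j _ b) (cong (λ x → if x then L else L ∸ 1) bj)

  gTop-graded : ∀ R (b : Subset n) → Graded R b (gTop (suc R) b)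
  gTop-graded R b = lower , separated
    where
    lower : ∀ j → R ≤ lookup (gTop (suc R) b) j
    lower j with lookup b j in bj
    ... | true  = ≤-trans (n≤1+n R) (≤-reflexive (sym (gTop-particle (suc R) b j bj)))
    ... | false = ≤-reflexive (sym (gTop-antiparticle (suc R) b j bj))

    separated : Separated b (gTop (suc R) b)
    separated j k bj bk = subst₂ _<_ (sym (gTop-antiparticle (suc R) b j bj)) (sym (gTop-particle (suc R) b k bk)) ≤-refl

  gStep-graded : ∀ {R} w b → (∀ j → suc R ≤ lookup w j) → Graded R b (gStep w b)
  gStep-graded {R} w b w> = lower , separated
    where
    open GStep w b

    lower : ∀ j → R ≤ lookup (gStep w b) j
    lower j with lookup b j in bj
    ... | true  = let c , _ , e = gStep-particle bj in
                  subst (R ≤_) (sym e) (≤-trans (n≤1+n R) (w> c))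
    ... | false = let c , _ , e = gStep-antiparticle bj in
                  subst (R ≤_) (sym e) (∸-monoˡ-≤ 1 (w> c))

    separated : Separated b (gStep w b)
    separated j k bj bk =
      let c , c∈ , ej = gStep-antiparticle bj
          c′ , c′∈ , ek = gStep-particle bk
      in begin-strict
        lookup (gStep w b) j  ≡⟨ ej ⟩
        lookup w c ∸ 1        <⟨ ∸-monoʳ-< z<s (≤-trans (s≤s z≤n) (w> c)) ⟩
        lookup w c            ≤⟨ taken≥dropped c′∈ c∈ ⟩
        lookup w c′           ≡⟨ ek ⟨
        lookup (gStep w b) k  ∎
      where open ≤-Reasoning

  -- Part (ii), row by row

  Agrees : ℕ → Subset n → Vec ℕ n → Vec ℕ n → Set
  Agrees R b v f = (∀ j → lookup b j ≡ true → lookup v j ≡ lookup f j) × (∀ j → lookup b j ≡ false → lookup v j ≡ R)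

  fromMaybe-irrelevant : ∀ {x y : ℕ} {mb} → mb ≢ nothing → fromMaybe x mb ≡ fromMaybe y mb
  fromMaybe-irrelevant {mb = just _}  _  = refl
  fromMaybe-irrelevant {mb = nothing} ≢n = ⊥-elim (≢n refl)

  lookup-fmFill-ball : ∀ r (b : Subset n) st j → lookup b j ≡ true
                     → lookup (finish 0 (fmFill r b st)) j ≡ fromMaybe r (lookup st j)
  lookup-fmFill-ball r b st j bj
    rewrite lookup-map j (fromMaybe 0) (fmFill r b st)
          | lookup-zipWith (λ x m → if x ∧ is-nothing m then just r else m) j b st
          | bj
    with lookup st j
  ... | just _  = refl
  ... | nothing = refl

  gTop-agrees : ∀ m (b : Subset n) → Agrees m b (gTop (suc m) b) (finish 0 (fmFill (suc m) b (replicate n nothing)))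
  gTop-agrees m b = particle , antiparticle
    where
    particle : ∀ j → lookup b j ≡ true → lookup (gTop (suc m) b) j ≡ lookup (finish 0 (fmFill (suc m) b (replicate n nothing))) j
    particle j bj = begin
      lookup (gTop (suc m) b) j                                             ≡⟨ gTop-particle (suc m) b j bj ⟩
      suc m                                                                 ≡⟨ cong (fromMaybe (suc m)) (lookup-replicate j nothing) ⟨
      fromMaybe (suc m) (lookup (replicate n nothing) j)                    ≡⟨ lookup-fmFill-ball (suc m) b (replicate n nothing) j bj ⟨
      lookup (finish 0 (fmFill (suc m) b (replicate n nothing))) j          ∎
      where open ≡-Reasoning

    antiparticle : ∀ j → lookup b j ≡ false → lookup (gTop (suc m) b) j ≡ m
    antiparticle j bj = gTop-antiparticle (suc m) b j bj

  module _ {m : ℕ} (w wF : Vec ℕ n) (b′ b : Subset n)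
           (separated : Separated b′ w) (agrees : Agrees (suc m) b′ w wF) (b′≤b : ∣ b′ ∣ ≤ ∣ b ∣) where

    open GStep w b

    private
      Ball? : Decidable (λ j → lookup b′ j ≡ true)
      Ball? j = lookup b′ j Bool.≟ true

      above below : List (Fin n)
      above = sortDec (lookup w) (filter Ball? (allFin n))
      below = sortDec (lookup w) (filter (∁? Ball?) (allFin n))

      k : ℕ
      k = ∣ b ∣ ∸ ∣ b′ ∣

      order-split : order ≡ above ++ below
      order-split = sortDec-partition (lookup w) Ball? (λ {x} {y} bx ¬by → separated y x (¬-not ¬by) bx) (allFin n)

      below-labels : All (λ c → lookup w c ≡ suc m) below
      below-labels = All-resp-↭ (↭-sym (sortDec-↭ (lookup w) (filter (∁? Ball?) (allFin n))))
        (All.map (λ ¬by → proj₂ agrees _ (¬-not ¬by)) (All.all-filter (∁? Ball?) (allFin n)))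

      ∣b∣≡ : ∣ b ∣ ≡ length above + k
      ∣b∣≡ = sym (trans (cong (_+ k) (trans (↭-length (sortDec-↭ (lookup w) (filter Ball? (allFin n)))) (length-filter-∈ b′)))
                        (m+[n∸m]≡n b′≤b))

      take-order : take ∣ b ∣ order ≡ above ++ take k below
      take-order = trans (cong₂ take ∣b∣≡ order-split) (take-++ above below k)

      drop-order : drop ∣ b ∣ order ≡ drop k below
      drop-order = trans (cong₂ drop ∣b∣≡ order-split) (drop-++ above below k)

      paired : Partial
      paired = Particles.run (replicate n nothing) above

      particlePhase-split : particlePhase ≡ Particles.run paired (take k below)
      particlePhase-split = trans (cong (Particles.run (replicate n nothing)) take-order)
                                  (foldl-++ Particles.step (replicate n nothing) above (take k below))

      fmPaired : Partial
      fmPaired = Greedy.run (lookup b) rightFrom (lookup wF) (replicate n nothing)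
                   (sortDec (lookup wF) (filter Ball? (allFin n)))

      fm-paired : fmPaired ≡ paired
      fm-paired = trans (cong (Greedy.run (lookup b) rightFrom (lookup wF) (replicate n nothing))
                              (sortDec-cong _ balls-agree))
                        (run-cong (lookup b) rightFrom (replicate n nothing) above
                              (All-resp-↭ (↭-sym (sortDec-↭ (lookup w) (filter Ball? (allFin n)))) balls-agree))
        where
        balls-agree : All (λ j → lookup wF j ≡ lookup w j) (filter Ball? (allFin n))
        balls-agree = All.map (λ bj → sym (proj₁ agrees _ bj)) (All.all-filter Ball? (allFin n))

    gStep-agrees : Agrees m b (gStep w b) (fmStep (suc m) wF b′ b)
    gStep-agrees = particle , antiparticle
      where
      open ≡-Reasoning

      particle : ∀ j → lookup b j ≡ true → lookup (gStep w b) j ≡ lookup (fmStep (suc m) wF b′ b) j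
      particle j bj = begin
        lookup (gStep w b) j                                  ≡⟨ lookup-gStep j ⟩
        fromMaybe 0 (lookup antiparticlePhase j)              ≡⟨ cong (fromMaybe 0) (antiparticles-keep-particles bj) ⟩
        fromMaybe 0 (lookup particlePhase j)                  ≡⟨ cong (λ st → fromMaybe 0 (lookup st j)) particlePhase-split ⟩
        fromMaybe 0 (lookup (Particles.run paired (take k below)) j) ≡⟨ completed ⟩
        fromMaybe (suc m) (lookup paired j)                   ≡⟨ cong (λ st → fromMaybe (suc m) (lookup st j)) fm-paired ⟨
        fromMaybe (suc m) (lookup fmPaired j)                 ≡⟨ lookup-fmFill-ball (suc m) b fmPaired j bj ⟨
        lookup (fmStep (suc m) wF b′ b) j                     ∎
        where
        completed : fromMaybe 0 (lookup (Particles.run paired (take k below)) j) ≡ fromMaybe (suc m) (lookup paired j)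
        completed with Particles.run-fate paired (take k below) j
        ... | Particles.kept e                = trans (cong (fromMaybe 0) e) (fromMaybe-irrelevant
                (λ none → particles-labelled bj (trans (cong (λ st → lookup st j) particlePhase-split) (trans e none))))
        ... | Particles.filled _ empty c∈ e   = trans (cong (fromMaybe 0) e)
                (trans (All.lookup (All.take⁺ k below-labels) c∈) (cong (fromMaybe (suc m)) (sym empty)))

      antiparticle : ∀ j → lookup b j ≡ false → lookup (gStep w b) j ≡ m
      antiparticle j bj =
        let c , c∈ , e = gStep-antiparticle bj
        in trans e (cong (_∸ 1) (All.lookup (All.drop⁺ k below-labels) (subst (c ∈ₗ_) drop-order c∈)))

module _ {n : ℕ} where

  -- B consists of the rows m+1, …, L of a configuration, so row i of B is row toℕ i + m + 1.
  LGaux-graded : ∀ {K} L m (B : Vec (Subset n) (suc K)) → L ≡ suc (K + m)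
               → ∀ i → Graded (toℕ i + m) (lookup B i) (lookup (LGaux L B) i)
  LGaux-graded L m (b ∷ [])      refl zero = gTop-graded m b
  LGaux-graded L m (b ∷ b′ ∷ bs) e    i    = rows i
    where
    rest : ∀ i → Graded (toℕ i + suc m) (lookup (b′ ∷ bs) i) (lookup (LGaux L (b′ ∷ bs)) i)
    rest = LGaux-graded L (suc m) (b′ ∷ bs) (trans e (cong suc (sym (+-suc _ m))))

    rows : ∀ i → Graded (toℕ i + m) (lookup (b ∷ b′ ∷ bs) i) (lookup (LGaux L (b ∷ b′ ∷ bs)) i)
    rows zero with LGaux L (b′ ∷ bs) | rest zero
    ... | w ∷ _ | w> , _ = gStep-graded w b w>
    rows (suc i) = subst (λ R → Graded R (lookup (b′ ∷ bs) i) (lookup (LGaux L (b′ ∷ bs)) i)) (+-suc (toℕ i) m) (rest i)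

  LGaux-agrees-FMaux : ∀ {K} L m (B : Vec (Subset n) (suc K)) → L ≡ suc (K + m)
                     → (∀ r s → r ≤ᶠ s → ∣ lookup B s ∣ ≤ ∣ lookup B r ∣)
                     → ∀ i → Agrees (toℕ i + m) (lookup B i) (lookup (LGaux L B) i) (lookup (FMaux (suc m) B) i)
  LGaux-agrees-FMaux L m (b ∷ [])      refl _    zero = gTop-agrees m b
  LGaux-agrees-FMaux L m (b ∷ b′ ∷ bs) e    ∣B∣↓ i    = rows i
    where
    L≡ : L ≡ suc (_ + suc m)
    L≡ = trans e (cong suc (sym (+-suc _ m)))

    rest : ∀ i → Agrees (toℕ i + suc m) (lookup (b′ ∷ bs) i) (lookup (LGaux L (b′ ∷ bs)) i)
                        (lookup (FMaux (suc (suc m)) (b′ ∷ bs)) i)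
    rest = LGaux-agrees-FMaux L (suc m) (b′ ∷ bs) L≡ (λ r s r≤s → ∣B∣↓ (suc r) (suc s) (s≤s r≤s))

    rows : ∀ i → Agrees (toℕ i + m) (lookup (b ∷ b′ ∷ bs) i) (lookup (LGaux L (b ∷ b′ ∷ bs)) i)
                        (lookup (FMaux (suc m) (b ∷ b′ ∷ bs)) i)
    rows zero with LGaux L (b′ ∷ bs) | FMaux (suc (suc m)) (b′ ∷ bs)
                 | LGaux-graded L (suc m) (b′ ∷ bs) L≡ zero | rest zero
    ... | w ∷ _ | wF ∷ _ | _ , separated | agrees = gStep-agrees w wF b′ b separated agrees (∣B∣↓ zero (suc zero) z≤n)
    rows (suc i) = subst (λ R → Agrees R (lookup (b′ ∷ bs) i) (lookup (LGaux L (b′ ∷ bs)) i)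
                                         (lookup (FMaux (suc (suc m)) (b′ ∷ bs)) i))
                         (+-suc (toℕ i) m) (rest i)

lemma3p29 : {n L : ℕ} (α : Vec ℕ L) (B : Vec (Subset n) L)
    → (∀ r → ∣ lookup B r ∣ ≡ lookup α r)
    → (∀ (r : Fin L) (j k : Fin n) → j ∉ lookup B r → k ∈ lookup B r
         → lookup (lookup (LG B) r) j < lookup (lookup (LG B) r) k)
      × ((∀ (r s : Fin L) → r ≤ᶠ s → lookup α s ≤ lookup α r)
         → (∀ (r : Fin L) (j : Fin n) → j ∈ lookup B r
              → lookup (lookup (LG B) r) j ≡ lookup (lookup (FM B) r) j)
           × (∀ (r : Fin L) (j : Fin n) → j ∉ lookup B r
              → lookup (lookup (LG B) r) j ≡ toℕ r))
lemma3p29 α [] _ = (λ ()) , λ _ → (λ ()) , (λ ())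
lemma3p29 {L = suc K} α B@(_ ∷ _) ∣B∣≡α =
    (λ r j k j∉ k∈ → proj₂ (graded r) j k (∉⇒lookup≡false j∉) ([]=⇒lookup k∈))
  , λ α↓ → let agrees = LGaux-agrees-FMaux (suc K) 0 B L≡ (∣B∣-decreasing α↓) in
        (λ r j j∈ → proj₁ (agrees r) j ([]=⇒lookup j∈))
      , (λ r j j∉ → trans (proj₂ (agrees r) j (∉⇒lookup≡false j∉)) (+-identityʳ (toℕ r)))
  where
  L≡ : suc K ≡ suc (K + 0)
  L≡ = cong suc (sym (+-identityʳ K))

  graded : ∀ r → Graded (toℕ r + 0) (lookup B r) (lookup (LG B) r)
  graded = LGaux-graded (suc K) 0 B L≡

  ∣B∣-decreasing : (∀ r s → r ≤ᶠ s → lookup α s ≤ lookup α r)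
                 → ∀ r s → r ≤ᶠ s → ∣ lookup B s ∣ ≤ ∣ lookup B r ∣
  ∣B∣-decreasing α↓ r s r≤s = subst₂ _≤_ (sym (∣B∣≡α s)) (sym (∣B∣≡α r)) (α↓ r s r≤s)
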